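{- Let $n\ge2$, $\pi\in S_n$, and let $p<q$ be such that $\{p,q\}=\{\pi(1),\pi(n)\}$. Let $1\le i<j\le n$ and let $\varphi\in S_{n-1}$ be the flip of $[i,j]$. Suppose that $\Lambda_{[i,j]}\subseteq\Lambda_{[p,q]}$, or $\Lambda_{[p,q]}\subseteq\Lambda_{[i,j]}$, or $\Lambda_{[i,j]}\cap\Lambda_{[p,q]}=\emptyset$; and suppose that for every $1\le m\le n-1$ we have $S^\pi_m\subseteq\Lambda_{[i,j]}$, or $\Lambda_{[i,j]}\subseteq S^\pi_m$, or $S^\pi_m\cap\Lambda_{[i,j]}=\emptyset$. Then $\varphi$ is valid with respect to $\pi$.
   Context: For $1\le s<t\le n$, the interval $[s,t]$ is identified with its set of levels $\Lambda_{[s,t]}=\{s,s+1,\dots,t-1\}\subseteq\{1,\dots,n-1\}$. For $\pi\in S_n$ and $1\le m\le n-1$, let $S^\pi_m=\Lambda_{[\min(\pi(m),\pi(m+1)),\max(\pi(m),\pi(m+1))]}$ and $\varepsilon^\pi_m=\operatorname{sgn}(\pi(m+1)-\pi(m))$. A permutation $\sigma\in S_{n-1}$ is valid with respect to $\pi$ if there exists $\tau\in S_n$ with $\{(\sigma(S^\pi_m),\varepsilon^\pi_m):1\le m\le n-1\}=\{(S^\tau_m,\varepsilon^\tau_m):1\le m\le n-1\}$ as sets (where $\sigma(S)=\{\sigma(x):x\in S\}$). The flip of $[i,j]$ ($1\le i<j\le n$) is the permutation $\varphi\in S_{n-1}$ with $\varphi(m)=i+j-1-m$ for $i\le m\le j-1$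 and $\varphi(m)=m$ otherwise. -}

module Defs where

-- Conventions (0-indexed): n = suc n' with n' ≥ 1.
--   positions and values of π ∈ S_n are Fin (suc n')  (paper's k ↦ k-1),
--   levels are Fin n'  (paper's level ℓ ∈ {1..n-1} ↦ ℓ-1).
-- Paper's interval [s,t] (values) has levels {s,…,t-1}; 0-indexed the
-- level set of the value interval [a,b] is { ℓ | a ≤ ℓ < b }.

open import Data.Nat as ℕ using (ℕ; zero; suc; _+_; _∸_; _⊓_; _⊔_; _≤?_; _<?_)
open import Data.Nat.Properties as ℕP
open import Data.Bool using (Bool; _∧_)
open import Data.Fin as Fin using (Fin; toℕ; fromℕ<; inject₁)
open import Data.Fin.Properties as FinP using (toℕ<n; toℕ-fromℕ<; toℕ-injective)
open import Data.Fin.Subset using (Subset; inside; outside; Side)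
open import Data.Fin.Permutation using (Permutation′; permutation; _⟨$⟩ʳ_; _⟨$⟩ˡ_)
open import Data.Vec using (tabulate; lookup)
open import Data.Product using (Σ; _×_; _,_; ∃)
open import Relation.Nullary using (yes; no; ¬_)
open import Relation.Nullary.Decidable using (⌊_⌋)
open import Relation.Binary.PropositionalEquality
open import Data.Empty using (⊥-elim)

Λ : {n' : ℕ} → ℕ → ℕ → Subset n'
Λ a b = tabulate λ ℓ → side (⌊ a ≤? toℕ ℓ ⌋ ∧ ⌊ toℕ ℓ <? b ⌋)
  where
  side : Bool → Side
  side Bool.true = inside
  side Bool.false = outside

ΛI : {n' : ℕ} → Fin (suc n') → Fin (suc n') → Subset n'
ΛI s t = Λ (toℕ s) (toℕ t)

Sπ : {n' : ℕ} → Permutation′ (suc n') → Fin n' → Subset n'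
Sπ π m = Λ (toℕ (π ⟨$⟩ʳ inject₁ m) ⊓ toℕ (π ⟨$⟩ʳ Fin.suc m))
           (toℕ (π ⟨$⟩ʳ inject₁ m) ⊔ toℕ (π ⟨$⟩ʳ Fin.suc m))

-- ε^π_m : true = +1 (π(m) < π(m+1)), false = -1 (values are distinct)
επ : {n' : ℕ} → Permutation′ (suc n') → Fin n' → Bool
επ π m = ⌊ toℕ (π ⟨$⟩ʳ inject₁ m) <? toℕ (π ⟨$⟩ʳ Fin.suc m) ⌋

image : {n' : ℕ} → Permutation′ n' → Subset n' → Subset n'
image σ S = tabulate λ y → lookup S (σ ⟨$⟩ˡ y)

-- σ ∈ S_{n-1} is valid w.r.t. π ∈ S_n: the two sets of pairs coincide
Valid : {n' : ℕ} → Permutation′ (suc n') → Permutation′ n' → Set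
Valid {n'} π σ = Σ (Permutation′ (suc n')) λ τ →
    ((m : Fin n') → Σ (Fin n') λ m' →
        (image σ (Sπ π m) ≡ Sπ τ m') × (επ π m ≡ επ τ m'))
  × ((m' : Fin n') → Σ (Fin n') λ m →
        (image σ (Sπ π m) ≡ Sπ τ m') × (επ π m ≡ επ τ m'))

-- The flip of [i,j] (0-indexed: values i < j in Fin (suc n')):
-- levels ℓ with i ≤ ℓ ≤ j-1 go to (i + (j-1)) - ℓ, others are fixed.
-- (Paper: φ(m) = i+j-1-m for i ≤ m ≤ j-1; shifting all of i, j, m down by 1
-- gives exactly this.)
flipℕ : ℕ → ℕ → ℕ → ℕ
flipℕ i zero x = x
flipℕ i (suc k) x with i ≤? x | x ≤? k
... | yes _ | yes _ = (i + k) ∸ x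
... | _     | _     = x

private
  rng : ∀ i k x → i ℕ.≤ x → x ℕ.≤ k →
        let y = (i + k) ∸ x in (i ℕ.≤ y) × (y ℕ.≤ k) × ((i + k) ∸ y ≡ x)
  rng i k x ix xk = i≤y , y≤k , back
    where
    y = (i + k) ∸ x
    x≤ik : x ℕ.≤ i + k
    x≤ik = ≤-trans xk (m≤n+m k i)
    eq : y + x ≡ i + k
    eq = m∸n+n≡m x≤ik
    i≤y : i ℕ.≤ y
    i≤y = +-cancelʳ-≤ x i y (subst (i + x ℕ.≤_) (sym eq) (+-monoʳ-≤ i xk))
    y≤k : y ℕ.≤ k
    y≤k = +-cancelʳ-≤ i y k (subst (y + i ℕ.≤_) (trans eq (+-comm i k))
                               (+-monoʳ-≤ y ix))
    back : (i + k) ∸ y ≡ x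
    back = trans (cong (_∸ y) (sym eq)) (m+n∸m≡n y x)

flipℕ-bound : ∀ {n'} i j x → j ℕ.≤ n' → x ℕ.< n' → flipℕ i j x ℕ.< n'
flipℕ-bound i zero x jn xn = xn
flipℕ-bound i (suc k) x jn xn with i ≤? x | x ≤? k
... | yes ix | yes xk = let (_ , yk , _) = rng i k x ix xk in ℕP.<-≤-trans (s≤s′ yk) jn
  where s≤s′ : ∀ {a b} → a ℕ.≤ b → a ℕ.< suc b
        s≤s′ = ℕ.s≤s
... | yes _ | no _ = xn
... | no _  | _    = xn

flipℕ-invol : ∀ i j x → flipℕ i j (flipℕ i j x) ≡ x
flipℕ-invol i zero x = refl
flipℕ-invol i (suc k) x with i ≤? x | x ≤? k
... | yes ix | yes xk with rng i k x ix xk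
...   | iy , yk , back with i ≤? (i + k) ∸ x | (i + k) ∸ x ≤? k
...     | yes _ | yes _ = back
...     | no ¬p | _     = ⊥-elim (¬p iy)
...     | yes _ | no ¬q = ⊥-elim (¬q yk)
flipℕ-invol i (suc k) x | yes ix | no ¬xk with i ≤? x | x ≤? k
... | yes _ | yes xk = ⊥-elim (¬xk xk)
... | yes _ | no _   = refl
... | no _  | _      = refl
flipℕ-invol i (suc k) x | no ¬ix | _ with i ≤? x | x ≤? k
... | yes ix | _ = ⊥-elim (¬ix ix)
... | no _   | yes _ = refl
... | no _   | no _  = refl

flipFin : {n' : ℕ} → Fin (suc n') → Fin (suc n') → Fin n' → Fin n'
flipFin {n'} i j ℓ = fromℕ< (flipℕ-bound (toℕ i) (toℕ j) (toℕ ℓ)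
                               (ℕP.≤-pred (toℕ<n j)) (toℕ<n ℓ))

flipFin-invol : {n' : ℕ} (i j : Fin (suc n')) (ℓ : Fin n') → flipFin i j (flipFin i j ℓ) ≡ ℓ
flipFin-invol i j ℓ = toℕ-injective
  (trans (toℕ-fromℕ< _)
    (trans (cong (flipℕ (toℕ i) (toℕ j)) (toℕ-fromℕ< _)) (flipℕ-invol (toℕ i) (toℕ j) (toℕ ℓ))))

flip : {n' : ℕ} → Fin (suc n') → Fin (suc n') → Permutation′ n'
flip i j = permutation (flipFin i j) (flipFin i j) (flipFin-invol i j) (flipFin-invol i j)

-- Close the path π(0), …, π(n) into a cycle by the step from π(n) back to π(0), whose level set
-- is Λ[p,q]; by hypothesis every step of the cycle is then laminar with Λ[i,j].  Laminarity forces
-- a step that leaves a value strictly between i and j to end in [i, j], so after rotating the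
-- cycle the positions carrying the values of [i, j] form one block whose ends carry i and j.
-- Reversing that block and reflecting its values v ↦ i + j − v gives τ: the steps inside the
-- block are carried by φ onto steps of τ, with the same sign since both order and values are
-- reversed, while a step with an endpoint outside [i, j] contains or avoids Λ[i,j], so φ fixes it.
-- Rotating τ until the closing steps correspond turns this cyclic matching into validity.

module Submission where

open import Defs
open import Data.Nat as ℕ
  using (ℕ; zero; suc; _+_; _∸_; _⊓_; _⊔_; _≤?_; _<?_; _≤_; _<_; z≤n; s≤s; z<s; >-nonZero)
open import Data.Nat.Properties
open import Data.Bool using (Bool; true; false; _∧_)
open import Data.Fin as Fin using (Fin; toℕ; fromℕ<; fromℕ; inject₁; lower₁)
open import Data.Fin.Properties
  using (toℕ-injective; toℕ<n; toℕ≤pred[n]; toℕ-fromℕ<; toℕ-fromℕ; toℕ-inject₁; toℕ-inject₁-≢; toℕ-lower₁;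
         inject₁-lower₁; fromℕ≢inject₁)
open import Data.Fin.Subset using (Subset; _∈_; _∉_; _⊆_; _∩_; ⊥)
open import Data.Fin.Subset.Properties using (⊆-antisym; x∈p∩q⁺; ∉⊥; ∩-comm; _∈?_)
open import Data.Fin.Permutation
  using (Permutation′; permutation; _⟨$⟩ʳ_; _⟨$⟩ˡ_; _∘ₚ_; inverseˡ; inverseʳ) renaming (flip to _⁻¹; id to idₚ)
open import Data.Vec using (lookup)
open import Data.Vec.Properties using (lookup∘tabulate; lookup⇒[]=; []=⇒lookup)
open import Data.Product using (Σ; ∃; ∃₂; _×_; _,_; proj₁; proj₂; map₂)
open import Data.Sum as Sum using (_⊎_; inj₁; inj₂; [_,_]′)
open import Data.Empty using (⊥-elim)
open import Function using (_∘_)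
open import Relation.Nullary using (Dec; yes; no; ¬_)
open import Relation.Nullary.Decidable using (⌊_⌋; _×-dec_; toSum)
open import Relation.Binary.PropositionalEquality
open import Relation.Binary.Definitions using (tri<; tri≈; tri>)

reflect-≤ : ∀ {u v U V} → U + u ≡ V + v → u ≤ v → V ≤ U
reflect-≤ {u} {v} {U} {V} eq u≤v =
  +-cancelʳ-≤ u V U (≤-trans (+-monoʳ-≤ V u≤v) (≤-reflexive (sym eq)))

reflect-< : ∀ {u v U V} → U + u ≡ V + v → u < v → V < U
reflect-< {u} {v} {U} {V} eq u<v =
  +-cancelʳ-< u V U (<-≤-trans (+-monoʳ-< V u<v) (≤-reflexive (sym eq)))

infix 4 _∈[_,_] _∈[_,_]?

_∈[_,_] : ℕ → ℕ → ℕ → Set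
x ∈[ a , b ] = a ≤ x × x ≤ b

_∈[_,_]? : ∀ x a b → Dec (x ∈[ a , b ])
x ∈[ a , b ]? = (a ≤? x) ×-dec (x ≤? b)

∉[]⇒ : ∀ {x a b} → ¬ x ∈[ a , b ] → x < a ⊎ b < x
∉[]⇒ {x} {a} {b} x∉ with a ≤? x
... | yes a≤x = inj₂ (≰⇒> λ x≤b → x∉ (a≤x , x≤b))
... | no a≰x  = inj₁ (≰⇒> a≰x)

flipℕ-inside : ∀ {i k x} → x ∈[ i , k ] → flipℕ i (suc k) x + x ≡ i + k
flipℕ-inside {i} {k} {x} (i≤x , x≤k) with i ≤? x | x ≤? k
... | yes _ | yes _  = m∸n+n≡m (≤-trans x≤k (m≤n+m k i))
... | no i≰x | _     = ⊥-elim (i≰x i≤x)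
... | yes _ | no x≰k = ⊥-elim (x≰k x≤k)

flipℕ-outside : ∀ {i k x} → ¬ x ∈[ i , k ] → flipℕ i (suc k) x ≡ x
flipℕ-outside {i} {k} {x} x∉ with i ≤? x | x ≤? k
... | yes i≤x | yes x≤k = ⊥-elim (x∉ (i≤x , x≤k))
... | yes _   | no _    = refl
... | no _    | _       = refl

flipℕ-trivial : ∀ i x → flipℕ i (suc i) x ≡ x
flipℕ-trivial i x with i ≤? x | x ≤? i
... | yes i≤x | yes x≤i rewrite ≤-antisym x≤i i≤x = m+n∸n≡m i i
... | yes _   | no _    = refl
... | no _    | _       = refl

module _ {m} {P Q : Fin (suc m)} {p q} (toℕ-P : toℕ P ≡ p) (toℕ-Q : toℕ Q ≡ suc q) where

  toℕ-flip : ∀ x → toℕ (flip P Q ⟨$⟩ʳ x) ≡ flipℕ p (suc q) (toℕ x)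
  toℕ-flip x = trans (toℕ-fromℕ< _) (cong₂ (λ p′ q′ → flipℕ p′ q′ (toℕ x)) toℕ-P toℕ-Q)

  flip-inside : ∀ {x} → toℕ x ∈[ p , q ] → toℕ (flip P Q ⟨$⟩ʳ x) + toℕ x ≡ p + q
  flip-inside {x} x∈ = trans (cong (_+ toℕ x) (toℕ-flip x)) (flipℕ-inside x∈)

  flip-outside : ∀ {x} → ¬ toℕ x ∈[ p , q ] → flip P Q ⟨$⟩ʳ x ≡ x
  flip-outside {x} x∉ = toℕ-injective (trans (toℕ-flip x) (flipℕ-outside x∉))

  flip-∈ : ∀ {x} → toℕ x ∈[ p , q ] → toℕ (flip P Q ⟨$⟩ʳ x) ∈[ p , q ]
  flip-∈ x∈@(p≤x , x≤q) = reflect-≤ sum x≤q , reflect-≤ (trans (+-comm q p) (sym sum)) p≤x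
    where sum = flip-inside x∈

  flip-unique : ∀ {x y} → toℕ x ∈[ p , q ] → toℕ y + toℕ x ≡ p + q → flip P Q ⟨$⟩ʳ x ≡ y
  flip-unique {x} x∈ sum = toℕ-injective (+-cancelʳ-≡ (toℕ x) _ _ (trans (flip-inside x∈) (sym sum)))

Λ-lookup : ∀ {n} a b (ℓ : Fin n) → lookup (Λ {n} a b) ℓ ≡ (⌊ a ≤? toℕ ℓ ⌋ ∧ ⌊ toℕ ℓ <? b ⌋)
Λ-lookup a b ℓ with ⌊ a ≤? toℕ ℓ ⌋ ∧ ⌊ toℕ ℓ <? b ⌋ | unfolded
  where
  unfolded : lookup (Λ a b) ℓ ≡ _
  unfolded = lookup∘tabulate _ ℓ
... | true  | eq = eq
... | false | eq = eq

∈Λ⁺ : ∀ {n a b} {ℓ : Fin n} → a ≤ toℕ ℓ → toℕ ℓ < b → ℓ ∈ Λ a b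
∈Λ⁺ {a = a} {b} {ℓ} a≤ℓ ℓ<b =
  lookup⇒[]= ℓ _ (trans (Λ-lookup a b ℓ) (decide (a ≤? toℕ ℓ) (toℕ ℓ <? b)))
  where
  decide : (p : Dec (a ≤ toℕ ℓ)) (q : Dec (toℕ ℓ < b)) → (⌊ p ⌋ ∧ ⌊ q ⌋) ≡ true
  decide (yes _) (yes _)  = refl
  decide (no a≰ℓ) _       = ⊥-elim (a≰ℓ a≤ℓ)
  decide (yes _) (no ℓ≮b) = ⊥-elim (ℓ≮b ℓ<b)

∈Λ⁻ : ∀ {n a b} {ℓ : Fin n} → ℓ ∈ Λ a b → a ≤ toℕ ℓ × toℕ ℓ < b
∈Λ⁻ {a = a} {b} {ℓ} ℓ∈Λ =
  decide (a ≤? toℕ ℓ) (toℕ ℓ <? b) (trans (sym (Λ-lookup a b ℓ)) ([]=⇒lookup ℓ∈Λ))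
  where
  decide : (p : Dec (a ≤ toℕ ℓ)) (q : Dec (toℕ ℓ < b)) → (⌊ p ⌋ ∧ ⌊ q ⌋) ≡ true →
           a ≤ toℕ ℓ × toℕ ℓ < b
  decide (yes a≤ℓ) (yes ℓ<b) _ = a≤ℓ , ℓ<b

∈image⁺ : ∀ {n} (σ : Permutation′ n) {S y} → σ ⟨$⟩ˡ y ∈ S → y ∈ image σ S
∈image⁺ σ {S} {y} σ⁻¹y∈S = lookup⇒[]= y _ (trans (lookup∘tabulate _ y) ([]=⇒lookup σ⁻¹y∈S))

∈image⁻ : ∀ {n} (σ : Permutation′ n) {S y} → y ∈ image σ S → σ ⟨$⟩ˡ y ∈ S
∈image⁻ σ {S} {y} y∈σS = lookup⇒[]= _ S (trans (sym (lookup∘tabulate _ y)) ([]=⇒lookup y∈σS))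

image-≡ : ∀ {n} (σ : Permutation′ n) {S T : Subset n} →
          (∀ {y} → σ ⟨$⟩ˡ y ∈ S → y ∈ T) → (∀ {y} → y ∈ T → σ ⟨$⟩ˡ y ∈ S) → image σ S ≡ T
image-≡ σ into onto = ⊆-antisym (into ∘ ∈image⁻ σ) (∈image⁺ σ ∘ onto)

Λspan : ∀ {n} → ℕ → ℕ → Subset n
Λspan u v = Λ (u ⊓ v) (u ⊔ v)

Λspan-comm : ∀ {n} u v → Λspan {n} u v ≡ Λspan v u
Λspan-comm u v = cong₂ Λ (⊓-comm u v) (⊔-comm u v)

Λspan-≤ : ∀ {n u v} → u ≤ v → Λspan {n} u v ≡ Λ u v
Λspan-≤ u≤v = cong₂ Λ (m≤n⇒m⊓n≡m u≤v) (m≤n⇒m⊔n≡n u≤v)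

Λspan-≥ : ∀ {n u v} → v ≤ u → Λspan {n} u v ≡ Λ v u
Λspan-≥ {u = u} {v} v≤u = trans (Λspan-comm u v) (Λspan-≤ v≤u)

level-∈Λ⁺ : ∀ {n a b l} (l<n : l < n) → a ≤ l → l < b → fromℕ< l<n ∈ Λ a b
level-∈Λ⁺ l<n a≤l l<b =
  ∈Λ⁺ (subst (_ ≤_) (sym (toℕ-fromℕ< l<n)) a≤l) (subst (_< _) (sym (toℕ-fromℕ< l<n)) l<b)

level-∈Λ⁻ : ∀ {n a b l} (l<n : l < n) → fromℕ< l<n ∈ Λ a b → a ≤ l × l < b
level-∈Λ⁻ l<n l∈Λ with ∈Λ⁻ l∈Λ
... | a≤l , l<b = subst (_ ≤_) (toℕ-fromℕ< l<n) a≤l , subst (_< _) (toℕ-fromℕ< l<n) l<b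

Laminar : ∀ {n} → Subset n → Subset n → Set
Laminar S T = S ⊆ T ⊎ (T ⊆ S ⊎ S ∩ T ≡ ⊥)

Laminar-sym : ∀ {n} {S T : Subset n} → Laminar S T → Laminar T S
Laminar-sym (inj₁ S⊆T)          = inj₂ (inj₁ S⊆T)
Laminar-sym (inj₂ (inj₁ T⊆S))   = inj₁ T⊆S
Laminar-sym {S = S} {T} (inj₂ (inj₂ S∩T≡⊥)) = inj₂ (inj₂ (trans (∩-comm T S) S∩T≡⊥))

∉-disjoint : ∀ {n} {S T : Subset n} {x} → S ∩ T ≡ ⊥ → x ∈ S → x ∉ T
∉-disjoint S∩T≡⊥ x∈S x∈T = ∉⊥ (subst (_ ∈_) S∩T≡⊥ (x∈p∩q⁺ (x∈S , x∈T)))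

Λ-crossing : ∀ {n a b c d} → a < c → c < b → b < d → d ≤ n → ¬ Laminar {n} (Λ a b) (Λ c d)
Λ-crossing {a = a} {b} {c} {d} a<c c<b b<d d≤n lam with lam
... | inj₁ S⊆T          = <⇒≱ a<c (proj₁ (level-∈Λ⁻ a<n (S⊆T (level-∈Λ⁺ a<n ≤-refl a<b))))
  where
  a<b = <-trans a<c c<b
  a<n = <-≤-trans (<-trans a<b b<d) d≤n
... | inj₂ (inj₁ T⊆S)   = <-irrefl refl (proj₂ (level-∈Λ⁻ b<n (T⊆S (level-∈Λ⁺ b<n (<⇒≤ c<b) b<d))))
  where b<n = <-≤-trans b<d d≤n
... | inj₂ (inj₂ S∩T≡⊥) =
  ∉-disjoint S∩T≡⊥ (level-∈Λ⁺ c<n (<⇒≤ a<c) c<b) (level-∈Λ⁺ c<n ≤-refl (<-trans c<b b<d))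
  where c<n = <-≤-trans (<-trans c<b b<d) d≤n

laminar-interior : ∀ {n i j x y} → y ≤ n → j ≤ n → i < x → x < j →
                   Laminar {n} (Λspan x y) (Λ i j) → i ≤ y × y ≤ j
laminar-interior {i = i} {j} {x} {y} y≤n j≤n i<x x<j lam with i ≤? y | y ≤? j
... | yes i≤y | yes y≤j = i≤y , y≤j
... | no i≰y  | _       =
  ⊥-elim (Λ-crossing y<i i<x x<j j≤n
            (subst (λ S → Laminar S _) (Λspan-≥ (<⇒≤ (<-trans y<i i<x))) lam))
  where y<i = ≰⇒> i≰y
... | yes _   | no y≰j  =
  ⊥-elim (Λ-crossing i<x x<j j<y y≤n
            (Laminar-sym (subst (λ S → Laminar S _) (Λspan-≤ (<⇒≤ (<-trans x<j j<y))) lam)))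
  where j<y = ≰⇒> y≰j

Λ-⊈ : ∀ {n a b i j} → a < b → b ≤ n → a < i ⊎ j < b → ¬ (Λ {n} a b ⊆ Λ i j)
Λ-⊈ {a = a} {suc b} a<b b<n (inj₁ a<i) S⊆T =
  <⇒≱ a<i (proj₁ (level-∈Λ⁻ a<n (S⊆T (level-∈Λ⁺ a<n ≤-refl a<b))))
  where a<n = <-≤-trans a<b b<n
Λ-⊈ {a = a} {suc b} a<b b<n (inj₂ j<b) S⊆T =
  <⇒≱ (proj₂ (level-∈Λ⁻ b<n (S⊆T (level-∈Λ⁺ b<n (<⇒≤pred a<b) ≤-refl)))) (<⇒≤pred j<b)

Λspan-⊈ : ∀ {n i j x y} → x ≢ y → x ≤ n → y ≤ n → y < i ⊎ j < y → ¬ (Λspan {n} x y ⊆ Λ i j)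
Λspan-⊈ {x = x} {y} x≢y x≤n y≤n y-out with <-cmp x y
... | tri≈ _ x≡y _ = ⊥-elim (x≢y x≡y)
... | tri< x<y _ _ = subst (λ S → ¬ (S ⊆ _)) (sym (Λspan-≤ (<⇒≤ x<y)))
                       (Λ-⊈ x<y y≤n (Sum.map₁ (<-trans x<y) y-out))
... | tri> _ _ y<x = subst (λ S → ¬ (S ⊆ _)) (sym (Λspan-≥ (<⇒≤ y<x)))
                       (Λ-⊈ y<x x≤n (Sum.map₂ (λ j<y → <-trans j<y y<x) y-out))

<?-reflect : ∀ {u v U V} → U + u ≡ V + v → ⌊ u <? v ⌋ ≡ ⌊ V <? U ⌋
<?-reflect {u} {v} {U} {V} eq with u <? v | V <? U
... | yes _   | yes _   = refl
... | no _    | no _    = refl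
... | yes u<v | no V≮U  = ⊥-elim (V≮U (reflect-< eq u<v))
... | no u≮v  | yes V<U = ⊥-elim (u≮v (reflect-< (trans (+-comm v V) (trans (sym eq) (+-comm U u))) V<U))

∈-nested : ∀ {n} {S T : Subset n} {x y} → T ⊆ S ⊎ S ∩ T ≡ ⊥ → x ∈ T → y ∈ T → x ∈ S → y ∈ S
∈-nested (inj₁ T⊆S)    _   y∈T _   = T⊆S y∈T
∈-nested (inj₂ S∩T≡⊥) x∈T _   x∈S = ⊥-elim (∉-disjoint S∩T≡⊥ x∈S x∈T)

module FlipAction {n} (I : Fin (suc n)) (K : Fin n) where

  private
    i = toℕ I
    k = toℕ K
    T : Subset n
    T = Λ i (suc k)

  φ : Permutation′ n
  φ = flip I (Fin.suc K)

  private
    ∈T⁺ : ∀ {ℓ} → toℕ ℓ ∈[ i , k ] → ℓ ∈ T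
    ∈T⁺ (i≤ℓ , ℓ≤k) = ∈Λ⁺ i≤ℓ (s≤s ℓ≤k)

    ∈T⁻ : ∀ {ℓ} → ℓ ∈ T → toℕ ℓ ∈[ i , k ]
    ∈T⁻ ℓ∈T = map₂ ≤-pred (∈Λ⁻ ℓ∈T)

  φ⁻¹-outside : ∀ {ℓ} → ℓ ∉ T → φ ⟨$⟩ˡ ℓ ≡ ℓ
  φ⁻¹-outside ℓ∉T = flip-outside refl refl (ℓ∉T ∘ ∈T⁺)

  φ⁻¹-inside : ∀ {ℓ} → ℓ ∈ T → toℕ (φ ⟨$⟩ˡ ℓ) + toℕ ℓ ≡ i + k
  φ⁻¹-inside ℓ∈T = flip-inside refl refl (∈T⁻ ℓ∈T)

  φ⁻¹-∈ : ∀ {ℓ} → ℓ ∈ T → φ ⟨$⟩ˡ ℓ ∈ T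
  φ⁻¹-∈ ℓ∈T = ∈T⁺ (flip-∈ refl refl (∈T⁻ ℓ∈T))

  image-φ-nested : ∀ {S} → T ⊆ S ⊎ S ∩ T ≡ ⊥ → image φ S ≡ S
  image-φ-nested {S} nested = image-≡ φ into onto
    where
    into : ∀ {y} → φ ⟨$⟩ˡ y ∈ S → y ∈ S
    into {y} φ⁻¹y∈S with y ∈? T
    ... | yes y∈T = ∈-nested nested (φ⁻¹-∈ y∈T) y∈T φ⁻¹y∈S
    ... | no y∉T  = subst (_∈ S) (φ⁻¹-outside y∉T) φ⁻¹y∈S
    onto : ∀ {y} → y ∈ S → φ ⟨$⟩ˡ y ∈ S
    onto {y} y∈S with y ∈? T
    ... | yes y∈T = ∈-nested nested y∈T (φ⁻¹-∈ y∈T) y∈S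
    ... | no y∉T  = subst (_∈ S) (sym (φ⁻¹-outside y∉T)) y∈S

  image-φ-trivial : ∀ {S} → k ≡ i → image φ S ≡ S
  image-φ-trivial {S} k≡i = image-≡ φ (subst (_∈ S) (φ⁻¹-id _)) (subst (_∈ S) (sym (φ⁻¹-id _)))
    where
    φ⁻¹-id : ∀ ℓ → φ ⟨$⟩ˡ ℓ ≡ ℓ
    φ⁻¹-id ℓ = toℕ-injective (trans (toℕ-flip {P = I} {Q = Fin.suc K} refl refl ℓ)
                                    (trans (cong (λ k′ → flipℕ i (suc k′) (toℕ ℓ)) k≡i) (flipℕ-trivial i (toℕ ℓ))))

  image-φ-Λ : ∀ {lo hi L H} → i ≤ lo → hi ≤ suc k → L + hi ≡ suc (i + k) → H + lo ≡ suc (i + k) →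
              image φ (Λ lo hi) ≡ Λ L H
  image-φ-Λ {lo} {hi} {L} {H} i≤lo hi≤j L+hi H+lo = image-≡ φ into onto
    where
    into : ∀ {y} → φ ⟨$⟩ˡ y ∈ Λ lo hi → y ∈ Λ L H
    into {y} φ⁻¹y∈ with ∈Λ⁻ φ⁻¹y∈ | y ∈? T
    ... | lo≤F , F<hi | yes y∈T =
      ∈Λ⁺ (reflect-≤ (trans (+-suc (toℕ y) _) (trans (cong suc y+F) (sym L+hi))) F<hi)
          (reflect-≤ (trans H+lo (cong suc (sym y+F))) lo≤F)
      where
      y+F : toℕ y + toℕ (φ ⟨$⟩ˡ y) ≡ i + k
      y+F = trans (+-comm (toℕ y) _) (φ⁻¹-inside y∈T)
    ... | lo≤F , F<hi | no y∉T =
      ⊥-elim (y∉T (∈Λ⁺ (≤-trans i≤lo (subst (lo ≤_) (cong toℕ φ⁻¹y≡y) lo≤F))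
                       (≤-trans (subst (_< hi) (cong toℕ φ⁻¹y≡y) F<hi) hi≤j)))
      where φ⁻¹y≡y = φ⁻¹-outside y∉T
    onto : ∀ {y} → y ∈ Λ L H → φ ⟨$⟩ˡ y ∈ Λ lo hi
    onto {y} y∈ with ∈Λ⁻ y∈
    ... | L≤y , y<H =
      ∈Λ⁺ (reflect-≤ (trans (+-suc F (toℕ y)) (trans (cong suc sum) (trans (sym H+lo) (+-comm H lo)))) y<H)
          (reflect-≤ (trans (+-comm hi L) (trans L+hi (cong suc (sym sum)))) L≤y)
      where
      i≤L = reflect-≤ (trans L+hi (sym (+-suc i k))) hi≤j
      H≤j = reflect-≤ (trans (trans (+-comm (suc k) i) (+-suc i k)) (sym H+lo)) i≤lo
      y∈T = ∈Λ⁺ (≤-trans i≤L L≤y) (<-≤-trans y<H H≤j)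
      F = toℕ (φ ⟨$⟩ˡ y)
      sum = φ⁻¹-inside y∈T

  image-φ-Λspan : ∀ {u v U V} → i ≤ u → u ≤ suc k → i ≤ v → v ≤ suc k →
                  U + u ≡ suc (i + k) → V + v ≡ suc (i + k) → image φ (Λspan u v) ≡ Λspan V U
  image-φ-Λspan {u} {v} {U} {V} i≤u u≤j i≤v v≤j U+u V+v with ≤-total u v
  ... | inj₁ u≤v = begin
    image φ (Λspan u v) ≡⟨ cong (image φ) (Λspan-≤ u≤v) ⟩
    image φ (Λ u v)     ≡⟨ image-φ-Λ i≤u v≤j V+v U+u ⟩
    Λ V U               ≡⟨ Λspan-≤ (reflect-≤ (trans U+u (sym V+v)) u≤v) ⟨
    Λspan V U           ∎
    where open ≡-Reasoning
  ... | inj₂ v≤u = begin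
    image φ (Λspan u v) ≡⟨ cong (image φ) (Λspan-≥ v≤u) ⟩
    image φ (Λ v u)     ≡⟨ image-φ-Λ i≤v u≤j U+u V+v ⟩
    Λ U V               ≡⟨ Λspan-≥ (reflect-≤ (trans V+v (sym U+u)) v≤u) ⟨
    Λspan V U           ∎
    where open ≡-Reasoning

⟨$⟩ʳ-injective : ∀ {n} (ρ : Permutation′ n) {x y} → ρ ⟨$⟩ʳ x ≡ ρ ⟨$⟩ʳ y → x ≡ y
⟨$⟩ʳ-injective ρ ρx≡ρy = trans (sym (inverseˡ ρ)) (trans (cong (ρ ⟨$⟩ˡ_) ρx≡ρy) (inverseˡ ρ))

next : ∀ {n} → Fin (suc n) → Fin (suc n)
next {n} x with n ℕ.≟ toℕ x
... | yes _   = Fin.zero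
... | no x≢n  = Fin.suc (lower₁ x x≢n)

prev : ∀ {n} → Fin (suc n) → Fin (suc n)
prev {n} Fin.zero    = fromℕ n
prev     (Fin.suc x) = inject₁ x

next-last : ∀ {n} → next (fromℕ n) ≡ Fin.zero
next-last {n} with n ℕ.≟ toℕ (fromℕ n)
... | yes _   = refl
... | no n≢n  = ⊥-elim (n≢n (sym (toℕ-fromℕ n)))

next-inject₁ : ∀ {n} (m : Fin n) → next (inject₁ m) ≡ Fin.suc m
next-inject₁ {n} m with n ℕ.≟ toℕ (inject₁ m)
... | yes n≡m = ⊥-elim (toℕ-inject₁-≢ m n≡m)
... | no n≢m  = cong Fin.suc (toℕ-injective (trans (toℕ-lower₁ _ n≢m) (toℕ-inject₁ m)))

next-prev : ∀ {n} (x : Fin (suc n)) → next (prev x) ≡ x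
next-prev Fin.zero    = next-last
next-prev (Fin.suc x) = next-inject₁ x

prev-next : ∀ {n} (x : Fin (suc n)) → prev (next x) ≡ x
prev-next {n} x with n ℕ.≟ toℕ x
... | yes n≡x = toℕ-injective (trans (toℕ-fromℕ n) n≡x)
... | no n≢x  = inject₁-lower₁ x n≢x

toℕ-next : ∀ {n} (x : Fin (suc n)) → toℕ x < n → toℕ (next x) ≡ suc (toℕ x)
toℕ-next {n} x x<n with n ℕ.≟ toℕ x
... | yes n≡x = ⊥-elim (<-irrefl (sym n≡x) x<n)
... | no n≢x  = cong suc (toℕ-lower₁ x n≢x)

toℕ-next⊎ : ∀ {n} (x : Fin (suc n)) → toℕ (next x) ≡ suc (toℕ x) ⊎ next x ≡ Fin.zero
toℕ-next⊎ {n} x with n ℕ.≟ toℕ x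
... | yes _   = inj₂ refl
... | no n≢x  = inj₁ (cong suc (toℕ-lower₁ x n≢x))

toℕ-prev : ∀ {n} (x : Fin (suc n)) {t} → toℕ x ≡ suc t → toℕ (prev x) ≡ t
toℕ-prev (Fin.suc x) x≡1+t = trans (toℕ-inject₁ x) (suc-injective x≡1+t)

next-≢ : ∀ {n} → 1 ≤ n → (x : Fin (suc n)) → next x ≢ x
next-≢ {n} 1≤n x next≡x with toℕ x <? n
... | yes x<n = 1+n≢n (trans (sym (toℕ-next x x<n)) (cong toℕ next≡x))
... | no x≮n  = <-irrefl (trans (cong toℕ 0≡x) x≡n) 1≤n
  where
  x≡n = ≤-antisym (≤-pred (toℕ<n x)) (≮⇒≥ x≮n)
  0≡x : Fin.zero ≡ x
  0≡x = trans (sym next-last) (trans (cong next (toℕ-injective (trans (toℕ-fromℕ n) (sym x≡n)))) next≡x)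

rotation : ∀ {n} → Permutation′ (suc n)
rotation = permutation next prev next-prev prev-next

rotate : ∀ {n} → Permutation′ (suc n) → Permutation′ (suc n)
rotate π = rotation ∘ₚ π

rotate^ : ∀ {n} → ℕ → Permutation′ (suc n) → Permutation′ (suc n)
rotate^ zero    π = π
rotate^ (suc r) π = rotate^ r (rotate π)

next^ : ∀ {n} → ℕ → Fin (suc n) → Fin (suc n)
next^ zero    x = x
next^ (suc r) x = next (next^ r x)

rotate^-apply : ∀ {n} r (π : Permutation′ (suc n)) x → rotate^ r π ⟨$⟩ʳ x ≡ π ⟨$⟩ʳ next^ r x
rotate^-apply zero    π x = refl
rotate^-apply (suc r) π x = rotate^-apply r (rotate π) x

next^-last : ∀ {n} t (x : Fin (suc n)) → toℕ x ≡ t → next^ (suc t) (fromℕ n) ≡ x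
next^-last zero    Fin.zero    _   = next-last
next^-last (suc t) (Fin.suc m) x≡t =
  trans (cong next (next^-last t (inject₁ m) (trans (toℕ-inject₁ m) (suc-injective x≡t)))) (next-inject₁ m)

-- Steps of the closed path π(0), …, π(n), π(0); the last one is the closing step.
Sᶜ : ∀ {n} → Permutation′ (suc n) → Fin (suc n) → Subset n
Sᶜ π x = Λspan (toℕ (π ⟨$⟩ʳ x)) (toℕ (π ⟨$⟩ʳ next x))

εᶜ : ∀ {n} → Permutation′ (suc n) → Fin (suc n) → Bool
εᶜ π x = ⌊ toℕ (π ⟨$⟩ʳ x) <? toℕ (π ⟨$⟩ʳ next x) ⌋

Sᶜ-≡ : ∀ {n} (π : Permutation′ (suc n)) {x u v} → π ⟨$⟩ʳ x ≡ u → π ⟨$⟩ʳ next x ≡ v →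
       Sᶜ π x ≡ Λspan (toℕ u) (toℕ v)
Sᶜ-≡ π refl refl = refl

εᶜ-≡ : ∀ {n} (π : Permutation′ (suc n)) {x u v} → π ⟨$⟩ʳ x ≡ u → π ⟨$⟩ʳ next x ≡ v →
       εᶜ π x ≡ ⌊ toℕ u <? toℕ v ⌋
εᶜ-≡ π refl refl = refl

Sᶜ-inject₁ : ∀ {n} (π : Permutation′ (suc n)) m → Sᶜ π (inject₁ m) ≡ Sπ π m
Sᶜ-inject₁ π m = Sᶜ-≡ π refl (cong (π ⟨$⟩ʳ_) (next-inject₁ m))

Sᶜ-last : ∀ {n} (π : Permutation′ (suc n)) →
          Sᶜ π (fromℕ n) ≡ Λspan (toℕ (π ⟨$⟩ʳ fromℕ n)) (toℕ (π ⟨$⟩ʳ Fin.zero))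
Sᶜ-last π = Sᶜ-≡ π refl (cong (π ⟨$⟩ʳ_) next-last)

εᶜ-inject₁ : ∀ {n} (π : Permutation′ (suc n)) m → εᶜ π (inject₁ m) ≡ επ π m
εᶜ-inject₁ π m = εᶜ-≡ π refl (cong (π ⟨$⟩ʳ_) (next-inject₁ m))

rotate^-steps : ∀ {n} {P : Subset n → Set} r (π : Permutation′ (suc n)) →
                (∀ x → P (Sᶜ π x)) → ∀ x → P (Sᶜ (rotate^ r π) x)
rotate^-steps zero    π steps = steps
rotate^-steps {P = P} (suc r) π steps = rotate^-steps {P = P} r (rotate π) (λ x → steps (next x))

record CyclicMatch {n} (π : Permutation′ (suc n)) (σ : Permutation′ n) (τ : Permutation′ (suc n)) : Set where
  field
    reindex    : Permutation′ (suc n)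
    image-step : ∀ x → image σ (Sᶜ π x) ≡ Sᶜ τ (reindex ⟨$⟩ʳ x)
    sign-step  : ∀ x → εᶜ π x ≡ εᶜ τ (reindex ⟨$⟩ʳ x)

open CyclicMatch

module _ {n} {π τ : Permutation′ (suc n)} {σ : Permutation′ n} where

  CyclicMatch-unrotate : CyclicMatch (rotate π) σ τ → CyclicMatch π σ τ
  CyclicMatch-unrotate c = record
    { reindex    = rotation ⁻¹ ∘ₚ reindex c
    ; image-step = λ x → subst (λ y → image σ (Sᶜ π y) ≡ Sᶜ τ (reindex c ⟨$⟩ʳ prev x)) (next-prev x)
                                 (image-step c (prev x))
    ; sign-step  = λ x → subst (λ y → εᶜ π y ≡ εᶜ τ (reindex c ⟨$⟩ʳ prev x)) (next-prev x)
                                 (sign-step c (prev x))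
    }

  CyclicMatch-rotate : CyclicMatch π σ τ → CyclicMatch π σ (rotate τ)
  CyclicMatch-rotate c = record
    { reindex    = reindex c ∘ₚ rotation ⁻¹
    ; image-step = λ x → trans (image-step c x) (cong (Sᶜ τ) (sym (next-prev _)))
    ; sign-step  = λ x → trans (sign-step c x) (cong (εᶜ τ) (sym (next-prev _)))
    }

CyclicMatch-unrotate^ : ∀ {n} r {π τ : Permutation′ (suc n)} {σ} →
                        CyclicMatch (rotate^ r π) σ τ → CyclicMatch π σ τ
CyclicMatch-unrotate^ zero    c = c
CyclicMatch-unrotate^ (suc r) c = CyclicMatch-unrotate (CyclicMatch-unrotate^ r c)

-- Rotating τ moves the image of the closing step one position back.
CyclicMatch-fixing-last : ∀ {n} {π τ : Permutation′ (suc n)} {σ} t (c : CyclicMatch π σ τ) →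
                          toℕ (reindex c ⟨$⟩ʳ fromℕ n) ≡ t →
                          ∃ λ τ′ → Σ (CyclicMatch π σ τ′) λ c′ → reindex c′ ⟨$⟩ʳ fromℕ n ≡ fromℕ n
CyclicMatch-fixing-last zero    c last↦0 =
  _ , CyclicMatch-rotate c , cong prev (toℕ-injective {j = Fin.zero} last↦0)
CyclicMatch-fixing-last (suc t) c last↦1+t =
  CyclicMatch-fixing-last t (CyclicMatch-rotate c) (toℕ-prev _ last↦1+t)

fixes-last⇒inject₁ : ∀ {n} (ρ : Permutation′ (suc n)) → ρ ⟨$⟩ʳ fromℕ n ≡ fromℕ n →
                     ∀ m → ∃ λ m′ → ρ ⟨$⟩ʳ inject₁ m ≡ inject₁ m′
fixes-last⇒inject₁ {n} ρ fixed m = lower₁ y n≢y , sym (inject₁-lower₁ y n≢y)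
  where
  y = ρ ⟨$⟩ʳ inject₁ m
  n≢y : n ≢ toℕ y
  n≢y n≡y = fromℕ≢inject₁ (sym (⟨$⟩ʳ-injective ρ (trans y≡last (sym fixed))))
    where y≡last = toℕ-injective (trans (sym n≡y) (sym (toℕ-fromℕ n)))

fixing-last⇒Valid : ∀ {n} {π τ : Permutation′ (suc n)} {σ} (c : CyclicMatch π σ τ) →
                    reindex c ⟨$⟩ʳ fromℕ n ≡ fromℕ n → Valid π σ
fixing-last⇒Valid {n} {π} {τ} {σ} c fixed = τ , forth , back
  where
  matched : ∀ {m m′} → reindex c ⟨$⟩ʳ inject₁ m ≡ inject₁ m′ →
            (image σ (Sπ π m) ≡ Sπ τ m′) × (επ π m ≡ επ τ m′)
  matched {m} {m′} m↦m′ =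
    trans (cong (image σ) (sym (Sᶜ-inject₁ π m)))
          (trans (image-step c _) (trans (cong (Sᶜ τ) m↦m′) (Sᶜ-inject₁ τ m′))) ,
    trans (sym (εᶜ-inject₁ π m)) (trans (sign-step c _) (trans (cong (εᶜ τ) m↦m′) (εᶜ-inject₁ τ m′)))
  fixed⁻¹ : reindex c ⟨$⟩ˡ fromℕ n ≡ fromℕ n
  fixed⁻¹ = trans (cong (reindex c ⟨$⟩ˡ_) (sym fixed)) (inverseˡ (reindex c))
  forth : ∀ m → ∃ λ m′ → (image σ (Sπ π m) ≡ Sπ τ m′) × (επ π m ≡ επ τ m′)
  forth m with fixes-last⇒inject₁ (reindex c) fixed m
  ... | m′ , m↦m′ = m′ , matched m↦m′
  back : ∀ m′ → ∃ λ m → (image σ (Sπ π m) ≡ Sπ τ m′) × (επ π m ≡ επ τ m′)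
  back m′ with fixes-last⇒inject₁ (reindex c ⁻¹) fixed⁻¹ m′
  ... | m , m′↤m = m , matched (trans (cong (reindex c ⟨$⟩ʳ_) (sym m′↤m)) (inverseʳ (reindex c)))

∈[]-split : ∀ {x a b} → x ∈[ a , b ] → x ≡ a ⊎ x ∈[ suc a , b ]
∈[]-split (a≤x , x≤b) with m≤n⇒m<n∨m≡n a≤x
... | inj₁ a<x = inj₂ (a<x , x≤b)
... | inj₂ a≡x = inj₁ (sym a≡x)

∈[]-splitʳ : ∀ {x a b} → x ∈[ a , suc b ] → x ≡ suc b ⊎ x ∈[ a , b ]
∈[]-splitʳ (a≤x , x≤b⁺) with m≤n⇒m<n∨m≡n x≤b⁺
... | inj₁ x<b⁺ = inj₂ (a≤x , ≤-pred x<b⁺)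
... | inj₂ x≡b⁺ = inj₁ x≡b⁺

module Runs {n} {P : Fin (suc n) → Set} (P? : ∀ x → Dec (P x)) (¬P-last : ¬ P (fromℕ n)) where

  HoldsOn : Fin (suc n) → Fin (suc n) → Set
  HoldsOn a b = ∀ x → toℕ x ∈[ toℕ a , toℕ b ] → P x

  record Run (a b : Fin (suc n)) : Set where
    field
      holds      : HoldsOn a b
      fails-prev : ¬ P (prev a)
      fails-next : ¬ P (next b)

  RightRun LeftRun : Fin (suc n) → Set
  RightRun z = ∃ λ b → toℕ z ≤ toℕ b × HoldsOn z b × ¬ P (next b)
  LeftRun  z = ∃ λ a → toℕ a ≤ toℕ z × HoldsOn a z × ¬ P (prev a)

  private
    singleton : ∀ {z} → P z → HoldsOn z z
    singleton Pz x (z≤x , x≤z) = subst P (toℕ-injective (≤-antisym z≤x x≤z)) Pz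

  run-right : ∀ t z → toℕ z + t ≡ n → P z → RightRun z
  run-right zero    z z+0≡n Pz = ⊥-elim (¬P-last (subst P z≡last Pz))
    where z≡last = toℕ-injective (trans (trans (sym (+-identityʳ _)) z+0≡n) (sym (toℕ-fromℕ n)))
  run-right (suc t) z z+t≡n Pz with P? (next z)
  ... | no ¬P-next = z , ≤-refl , singleton Pz , ¬P-next
  ... | yes P-next = extend (run-right t (next z) next-z+t≡n P-next)
    where
    next-z : toℕ (next z) ≡ suc (toℕ z)
    next-z = toℕ-next z (subst (toℕ z <_) z+t≡n (m<m+n (toℕ z) z<s))
    next-z+t≡n : toℕ (next z) + t ≡ n
    next-z+t≡n = trans (cong (_+ t) next-z) (trans (sym (+-suc _ t)) z+t≡n)
    extend : RightRun (next z) → RightRun z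
    extend (b , next-z≤b , holds , ¬P-next-b) =
      b , ≤-trans (n≤1+n _) (subst (_≤ toℕ b) next-z next-z≤b) , holds′ , ¬P-next-b
      where
      holds′ : HoldsOn z b
      holds′ x x∈ = [ (λ x≡z → subst P (toℕ-injective (sym x≡z)) Pz)
                    , (λ (z<x , x≤b) → holds x (subst (_≤ toℕ x) (sym next-z) z<x , x≤b)) ]′ (∈[]-split x∈)

  run-left : ∀ t z → toℕ z ≡ t → P z → LeftRun z
  run-left zero    z z≡0 Pz = z , ≤-refl , singleton Pz , subst (λ y → ¬ P (prev y)) (sym z≡0′) ¬P-last
    where z≡0′ = toℕ-injective {j = Fin.zero} z≡0
  run-left (suc t) z z≡1+t Pz with P? (prev z)
  ... | no ¬P-prev = z , ≤-refl , singleton Pz , ¬P-prev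
  ... | yes P-prev = extend (run-left t (prev z) prev-z P-prev)
    where
    prev-z : toℕ (prev z) ≡ t
    prev-z = toℕ-prev z z≡1+t
    prev-z≤z : toℕ (prev z) ≤ toℕ z
    prev-z≤z = subst (toℕ (prev z) ≤_) (sym z≡1+t) (≤-trans (≤-reflexive prev-z) (n≤1+n t))
    extend : LeftRun (prev z) → LeftRun z
    extend (a , a≤prev-z , holds , ¬P-prev-a) =
      a , ≤-trans a≤prev-z prev-z≤z , holds′ , ¬P-prev-a
      where
      holds′ : HoldsOn a z
      holds′ x x∈ = [ (λ x≡1+t → subst P (toℕ-injective (sym (trans x≡1+t (sym z≡1+t)))) Pz)
                    , (λ (a≤x , x≤t) → holds x (a≤x , subst (toℕ x ≤_) (sym prev-z) x≤t)) ]′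
                    (∈[]-splitʳ (subst (toℕ x ∈[ toℕ a ,_]) z≡1+t x∈))

  maximal-run : ∀ {z} → P z → ∃₂ λ a b → toℕ z ∈[ toℕ a , toℕ b ] × Run a b
  maximal-run {z} Pz with run-left (toℕ z) z refl Pz
                        | run-right (n ∸ toℕ z) z (m+[n∸m]≡n (toℕ≤pred[n] z)) Pz
  ... | a , a≤z , holdsˡ , ¬P-prev | b , z≤b , holdsʳ , ¬P-next =
    a , b , (a≤z , z≤b) , record { holds = holds ; fails-prev = ¬P-prev ; fails-next = ¬P-next }
    where
    holds : HoldsOn a b
    holds x (a≤x , x≤b) with ≤-total (toℕ x) (toℕ z)
    ... | inj₁ x≤z = holdsˡ x (a≤x , x≤z)
    ... | inj₂ z≤x = holdsʳ x (z≤x , x≤b)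

module Reflection {n} (1≤n : 1 ≤ n) (π : Permutation′ (suc n)) (I : Fin (suc n)) (K : Fin n)
                  (laminar : ∀ x → Laminar (Sᶜ π x) (Λ (toℕ I) (suc (toℕ K)))) where

  open FlipAction I K public

  i j : ℕ
  i = toℕ I
  j = suc (toℕ K)

  value : Fin (suc n) → ℕ
  value x = toℕ (π ⟨$⟩ʳ x)

  InBand : Fin (suc n) → Set
  InBand x = value x ∈[ i , j ]

  -- Reflection v ↦ i + j − v of the values i, …, j.
  ψ : Permutation′ (suc n)
  ψ = flip (inject₁ I) (Fin.suc (Fin.suc K))

  ψ-inside : ∀ {v} → toℕ v ∈[ i , j ] → toℕ (ψ ⟨$⟩ʳ v) + toℕ v ≡ suc (i + toℕ K)
  ψ-inside v∈ = trans (flip-inside (toℕ-inject₁ I) refl v∈) (+-suc i (toℕ K))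

  ψ-outside : ∀ {v} → ¬ toℕ v ∈[ i , j ] → ψ ⟨$⟩ʳ v ≡ v
  ψ-outside = flip-outside (toℕ-inject₁ I) refl

  ψ-involutive : ∀ v → ψ ⟨$⟩ʳ (ψ ⟨$⟩ʳ v) ≡ v
  ψ-involutive = flipFin-invol (inject₁ I) (Fin.suc (Fin.suc K))

  value-≢ : ∀ x → value x ≢ value (next x)
  value-≢ x eq = next-≢ 1≤n x (sym (⟨$⟩ʳ-injective π (toℕ-injective eq)))

  StepMatch : Permutation′ (suc n) → Fin (suc n) → Fin (suc n) → Set
  StepMatch τ x y = (image φ (Sᶜ π x) ≡ Sᶜ τ y) × (εᶜ π x ≡ εᶜ τ y)

  step-reflected : ∀ {τ} x y → τ ⟨$⟩ʳ y ≡ ψ ⟨$⟩ʳ (π ⟨$⟩ʳ next x) → τ ⟨$⟩ʳ next y ≡ ψ ⟨$⟩ʳ (π ⟨$⟩ʳ x) →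
                   InBand x → InBand (next x) → StepMatch τ x y
  step-reflected {τ} x y τy τy⁺ x∈@(i≤u , u≤j) x⁺∈@(i≤v , v≤j) =
    trans (image-φ-Λspan i≤u u≤j i≤v v≤j (ψ-inside x∈) (ψ-inside x⁺∈)) (sym (Sᶜ-≡ τ τy τy⁺)) ,
    trans (<?-reflect (trans (ψ-inside x∈) (sym (ψ-inside x⁺∈)))) (sym (εᶜ-≡ τ τy τy⁺))

  step-fixed : ∀ {τ} x y → τ ⟨$⟩ʳ y ≡ π ⟨$⟩ʳ x → τ ⟨$⟩ʳ next y ≡ π ⟨$⟩ʳ next x →
               ¬ InBand x ⊎ ¬ InBand (next x) → StepMatch τ x y
  step-fixed {τ} x y τy τy⁺ endpoint-out =
    trans (image-φ-nested (nested (laminar x))) (sym (Sᶜ-≡ τ τy τy⁺)) , sym (εᶜ-≡ τ τy τy⁺)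
    where
    u = value x
    v = value (next x)
    ⊈T : ¬ InBand x ⊎ ¬ InBand (next x) → ¬ (Sᶜ π x ⊆ Λ i j)
    ⊈T (inj₂ v∉) = Λspan-⊈ (value-≢ x) (toℕ≤pred[n] _) (toℕ≤pred[n] _) (∉[]⇒ v∉)
    ⊈T (inj₁ u∉) = subst (λ S → ¬ (S ⊆ Λ i j)) (Λspan-comm v u)
                      (Λspan-⊈ (value-≢ x ∘ sym) (toℕ≤pred[n] _) (toℕ≤pred[n] _) (∉[]⇒ u∉))
    nested : Laminar (Sᶜ π x) (Λ i j) → Λ i j ⊆ Sᶜ π x ⊎ Sᶜ π x ∩ Λ i j ≡ ⊥
    nested (inj₁ S⊆T)          = ⊥-elim (⊈T endpoint-out S⊆T)
    nested (inj₂ T⊆S⊎disjoint) = T⊆S⊎disjoint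

  matched-by-steps : ∀ {τ} (G : Permutation′ (suc n)) → (∀ x → StepMatch τ x (G ⟨$⟩ʳ x)) →
                     CyclicMatch π φ τ
  matched-by-steps G steps = record
    { reindex = G ; image-step = λ x → proj₁ (steps x) ; sign-step = λ x → proj₂ (steps x) }

  -- τ reverses the block of positions A, …, B and reflects its values; G reverses the steps inside it.
  module Block (A B : Fin (suc n)) (A<B : toℕ A < toℕ B)
               (block-inside : ∀ x → toℕ x ∈[ toℕ A , toℕ B ] → InBand x) where

    a b b′ : ℕ
    a = toℕ A
    b = toℕ B
    b′ = ℕ.pred b

    b≡1+b′ : b ≡ suc b′
    b≡1+b′ = sym (suc-pred b ⦃ >-nonZero (≤-<-trans z≤n A<B) ⦄)

    R G τ : Permutation′ (suc n)
    R = flip (inject₁ A) (Fin.suc B)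
    G = flip (inject₁ A) (inject₁ B)
    τ = R ∘ₚ π ∘ₚ ψ

    sum-b : suc (a + b′) ≡ a + b
    sum-b = trans (sym (+-suc a b′)) (cong (a +_) (sym b≡1+b′))

    toℕ-inject₁-B : toℕ (inject₁ B) ≡ suc b′
    toℕ-inject₁-B = trans (toℕ-inject₁ B) b≡1+b′

    τ-via-R : ∀ {x y} → R ⟨$⟩ʳ x ≡ y → τ ⟨$⟩ʳ x ≡ ψ ⟨$⟩ʳ (π ⟨$⟩ʳ y)
    τ-via-R = cong (λ z → ψ ⟨$⟩ʳ (π ⟨$⟩ʳ z))

    R-unique : ∀ {x y} → toℕ x ∈[ a , b ] → toℕ y + toℕ x ≡ a + b → R ⟨$⟩ʳ x ≡ y
    R-unique = flip-unique {P = inject₁ A} {Q = Fin.suc B} (toℕ-inject₁ A) refl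

    R-outside : ∀ {x} → ¬ toℕ x ∈[ a , b ] → R ⟨$⟩ʳ x ≡ x
    R-outside = flip-outside {P = inject₁ A} {Q = Fin.suc B} (toℕ-inject₁ A) refl

    G-outside : ∀ {x} → ¬ toℕ x ∈[ a , b′ ] → G ⟨$⟩ʳ x ≡ x
    G-outside = flip-outside {P = inject₁ A} {Q = inject₁ B} (toℕ-inject₁ A) toℕ-inject₁-B

    b≤n : b ≤ n
    b≤n = toℕ≤pred[n] B

    widen : ∀ {x} → x ∈[ a , b′ ] → x ∈[ a , b ]
    widen (a≤x , x≤b′) = a≤x , subst (_ ≤_) (sym b≡1+b′) (≤-trans x≤b′ (n≤1+n b′))

    shift : ∀ {x} → x ∈[ a , b′ ] → suc x ∈[ a , b ]
    shift (a≤x , x≤b′) = ≤-trans a≤x (n≤1+n _) , subst (_ ≤_) (sym b≡1+b′) (s≤s x≤b′)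

    toℕ-next-in-block : ∀ {x} → toℕ x ∈[ a , b′ ] → toℕ (next x) ≡ suc (toℕ x)
    toℕ-next-in-block {x} (_ , x≤b′) = toℕ-next x (<-≤-trans (s≤s x≤b′) (subst (_≤ n) b≡1+b′ b≤n))

    inner-step : ∀ {x : Fin (suc n)} → toℕ x ∈[ a , b′ ] → StepMatch τ x (G ⟨$⟩ʳ x)
    inner-step {x} x∈ =
      step-reflected {τ} x y (τ-via-R R-y) (τ-via-R R-next-y)
        (block-inside x (widen x∈)) (block-inside (next x) (subst (_∈[ a , b ]) (sym next-x) (shift x∈)))
      where
      y = G ⟨$⟩ʳ x
      y+x : toℕ y + toℕ x ≡ a + b′
      y+x = flip-inside (toℕ-inject₁ A) toℕ-inject₁-B x∈
      y∈ : toℕ y ∈[ a , b′ ]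
      y∈ = flip-∈ (toℕ-inject₁ A) toℕ-inject₁-B x∈
      next-x = toℕ-next-in-block x∈
      next-y = toℕ-next-in-block y∈
      R-y : R ⟨$⟩ʳ y ≡ next x
      R-y = R-unique (widen y∈)
              (trans (cong (_+ toℕ y) next-x) (trans (cong suc (trans (+-comm (toℕ x) (toℕ y)) y+x)) sum-b))
      R-next-y : R ⟨$⟩ʳ next y ≡ x
      R-next-y = R-unique (subst (_∈[ a , b ]) (sym next-y) (shift y∈))
                   (trans (cong (toℕ x +_) next-y) (trans (+-comm (toℕ x) _) (trans (cong suc y+x) sum-b)))

    not-interior : ∀ {y : Fin (suc n)} → toℕ y < a ⊎ b ≤ toℕ y → ¬ (a < toℕ y × toℕ y < b)
    not-interior (inj₁ y<a) (a<y , _)   = <-asym y<a a<y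
    not-interior (inj₂ b≤y) (_   , y<b) = <⇒≱ y<b b≤y

    next-not-interior : ∀ {x : Fin (suc n)} → toℕ x < a ⊎ b ≤ toℕ x →
                        ¬ (a < toℕ (next x) × toℕ (next x) < b)
    next-not-interior {x} x-side with toℕ-next⊎ x
    ... | inj₂ next≡0   = λ (a<0 , _) → <⇒≱ (subst (a <_) (cong toℕ next≡0) a<0) z≤n
    ... | inj₁ next≡1+x = λ (a<x⁺ , x⁺<b) →
      [ (λ x<a → <⇒≱ (subst (a <_) next≡1+x a<x⁺) x<a)
      , (λ b≤x → <⇒≱ (subst (_< b) next≡1+x x⁺<b) (≤-trans b≤x (n≤1+n _))) ]′ x-side

    -- ψA≡B says that the two ends of the block carry the values i and j.
    module Arc (b<n : b < n) (ψA≡B : ψ ⟨$⟩ʳ (π ⟨$⟩ʳ A) ≡ π ⟨$⟩ʳ B)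
               (block-outside : ∀ x → ¬ toℕ x ∈[ a , b ] → ¬ InBand x) where

      τ-fixes : ∀ y → ¬ (a < toℕ y × toℕ y < b) → τ ⟨$⟩ʳ y ≡ π ⟨$⟩ʳ y
      τ-fixes y y-not-interior with toℕ y ∈[ a , b ]?
      ... | no y∉ = trans (τ-via-R (R-outside y∉))
                          (ψ-outside (block-outside y y∉))
      ... | yes y∈@(a≤y , y≤b) with a <? toℕ y
      ...   | yes a<y = trans (τ-via-R R-y) (trans ψA≡B (cong (π ⟨$⟩ʳ_) (sym y≡B)))
        where
        y≡b = ≤-antisym y≤b (≮⇒≥ λ y<b → y-not-interior (a<y , y<b))
        y≡B = toℕ-injective y≡b
        R-y : R ⟨$⟩ʳ y ≡ A
        R-y = R-unique y∈ (cong (a +_) y≡b)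
      ...   | no a≮y = trans (τ-via-R R-y)
                             (trans (cong (ψ ⟨$⟩ʳ_) (sym ψA≡B)) (trans (ψ-involutive _) (cong (π ⟨$⟩ʳ_) (sym y≡A))))
        where
        y≡a = ≤-antisym (≮⇒≥ a≮y) a≤y
        y≡A = toℕ-injective y≡a
        R-y : R ⟨$⟩ʳ y ≡ B
        R-y = R-unique y∈ (trans (+-comm b (toℕ y)) (cong (_+ b) y≡a))

      endpoint-outside : ∀ {x : Fin (suc n)} → toℕ x < a ⊎ b ≤ toℕ x → ¬ InBand x ⊎ ¬ InBand (next x)
      endpoint-outside {x} (inj₁ x<a) = inj₁ (block-outside x λ (a≤x , _) → <⇒≱ x<a a≤x)
      endpoint-outside {x} (inj₂ b≤x) with m≤n⇒m<n∨m≡n b≤x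
      ... | inj₁ b<x = inj₁ (block-outside x λ (_ , x≤b) → <⇒≱ b<x x≤b)
      ... | inj₂ b≡x = inj₂ (block-outside (next x) λ (_ , x⁺≤b) →
                               <⇒≱ (subst (b <_) (sym next-x) (s≤s b≤x)) x⁺≤b)
        where next-x = toℕ-next x (subst (_< n) b≡x b<n)

      outer-step : ∀ {x : Fin (suc n)} → ¬ toℕ x ∈[ a , b′ ] → StepMatch τ x (G ⟨$⟩ʳ x)
      outer-step {x} x∉ = subst (StepMatch τ x) (sym G-x) fixed
        where
        x-side : toℕ x < a ⊎ b ≤ toℕ x
        x-side = Sum.map₂ (subst (_≤ toℕ x) (sym b≡1+b′)) (∉[]⇒ x∉)
        G-x : G ⟨$⟩ʳ x ≡ x
        G-x = G-outside x∉
        fixed : StepMatch τ x x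
        fixed = step-fixed {τ} x x (τ-fixes x (not-interior x-side))
                                   (τ-fixes (next x) (next-not-interior x-side))
                                   (endpoint-outside x-side)

      arc-match : CyclicMatch π φ τ
      arc-match = matched-by-steps G step
        where
        step : ∀ x → StepMatch τ x (G ⟨$⟩ʳ x)
        step x = [ inner-step , outer-step ]′ (toSum (toℕ x ∈[ a , b′ ]?))

  -- When every value lies in [i, j], the block is the whole cycle.
  module Whole (all-inside : ∀ x → InBand x) where

    open Block Fin.zero (fromℕ n) (subst (0 <_) (sym (toℕ-fromℕ n)) 1≤n) (λ x _ → all-inside x)

    closing-step : StepMatch τ (fromℕ n) (G ⟨$⟩ʳ fromℕ n)
    closing-step =
      subst (StepMatch τ (fromℕ n)) (sym G-last)
        (step-reflected {τ} (fromℕ n) (fromℕ n)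
          (τ-via-R {x = fromℕ n} (trans R-last (sym next-last)))
          (τ-via-R {x = next (fromℕ n)} (trans (cong (R ⟨$⟩ʳ_) next-last) R-0))
          (all-inside _) (all-inside _))
      where
      G-last : G ⟨$⟩ʳ fromℕ n ≡ fromℕ n
      G-last = G-outside λ (_ , b≤b′) → 1+n≰n (subst (_≤ b′) b≡1+b′ b≤b′)
      R-last : R ⟨$⟩ʳ fromℕ n ≡ Fin.zero
      R-last = R-unique (z≤n , ≤-refl) refl
      R-0 : R ⟨$⟩ʳ Fin.zero ≡ fromℕ n
      R-0 = R-unique (z≤n , z≤n) (+-identityʳ b)

    whole-match : CyclicMatch π φ τ
    whole-match = matched-by-steps G step
      where
      step : ∀ x → StepMatch τ x (G ⟨$⟩ʳ x)
      step x = [ inner-step , (λ x∉ → subst (λ y → StepMatch τ y (G ⟨$⟩ʳ y)) (sym (x≡last x∉)) closing-step) ]′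
                 (toSum (toℕ x ∈[ a , b′ ]?))
        where
        x≡last : ¬ toℕ x ∈[ a , b′ ] → x ≡ fromℕ n
        x≡last x∉ = toℕ-injective (≤-antisym (subst (toℕ x ≤_) (sym (toℕ-fromℕ n)) (toℕ≤pred[n] x))
                                             (subst (_≤ toℕ x) (sym b≡1+b′) (≰⇒> (x∉ ∘ (z≤n ,_)))))

  Interior : Fin (suc n) → Set
  Interior x = i < value x × value x < j

  InBand? : ∀ x → Dec (InBand x)
  InBand? x = value x ∈[ i , j ]?

  interior-next : ∀ {x} → Interior x → InBand (next x)
  interior-next {x} (i<u , u<j) = laminar-interior (toℕ≤pred[n] _) (toℕ<n K) i<u u<j (laminar x)

  interior-prev : ∀ {x} → Interior x → InBand (prev x)
  interior-prev {x} (i<u , u<j) =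
    laminar-interior (toℕ≤pred[n] _) (toℕ<n K) i<u u<j
      (subst (λ S → Laminar S (Λ i j)) Sᶜ-prev (laminar (prev x)))
    where
    Sᶜ-prev : Sᶜ π (prev x) ≡ Λspan (value x) (value (prev x))
    Sᶜ-prev = trans (Sᶜ-≡ π refl (cong (π ⟨$⟩ʳ_) (next-prev x))) (Λspan-comm (value (prev x)) (value x))

  boundary-value : ∀ {x} → InBand x → ¬ Interior x → value x ≡ i ⊎ value x ≡ j
  boundary-value (i≤u , u≤j) ¬interior with m≤n⇒m<n∨m≡n i≤u
  ... | inj₂ i≡u = inj₁ (sym i≡u)
  ... | inj₁ i<u with m≤n⇒m<n∨m≡n u≤j
  ...   | inj₁ u<j = ⊥-elim (¬interior (i<u , u<j))
  ...   | inj₂ u≡j = inj₂ u≡j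

  -- The positions with values in [i, j] form one block around the position of the value i + 1.
  module LocateArc (last-out : ¬ InBand (fromℕ n)) (i+1<j : suc i < j) where

    open Runs InBand? last-out
    open Run

    run-ends : ∀ {a b} → Run a b → ¬ Interior a × ¬ Interior b
    run-ends r = (λ a-interior → fails-prev r (interior-prev a-interior))
               , (λ b-interior → fails-next r (interior-next b-interior))

    i+1<1+n : suc i < suc n
    i+1<1+n = m<n⇒m<1+n (<-≤-trans i+1<j (toℕ<n K))

    z₀ : Fin (suc n)
    z₀ = π ⟨$⟩ˡ fromℕ< i+1<1+n

    z₀-interior : Interior z₀
    z₀-interior = subst (λ v → i < v × v < j) (sym value-z₀) (≤-refl , i+1<j)
      where
      value-z₀ : value z₀ ≡ suc i
      value-z₀ = trans (cong toℕ (inverseʳ π)) (toℕ-fromℕ< i+1<1+n)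

    arc : ∃₂ λ a b → toℕ z₀ ∈[ toℕ a , toℕ b ] × Run a b
    arc = maximal-run (<⇒≤ (proj₁ z₀-interior) , <⇒≤ (proj₂ z₀-interior))

    A B : Fin (suc n)
    A = proj₁ arc
    B = proj₁ (proj₂ arc)

    z₀∈ : toℕ z₀ ∈[ toℕ A , toℕ B ]
    z₀∈ = proj₁ (proj₂ (proj₂ arc))

    run : Run A B
    run = proj₂ (proj₂ (proj₂ arc))


    A-in : InBand A
    A-in = holds run A (≤-refl , ≤-trans (proj₁ z₀∈) (proj₂ z₀∈))

    B-in : InBand B
    B-in = holds run B (≤-trans (proj₁ z₀∈) (proj₂ z₀∈) , ≤-refl)

    A<B : toℕ A < toℕ B
    A<B = <-trans (≤∧≢⇒< (proj₁ z₀∈) λ A≡z₀ → A-end (subst Interior (sym (toℕ-injective A≡z₀)) z₀-interior))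
                  (≤∧≢⇒< (proj₂ z₀∈) λ z₀≡B → B-end (subst Interior (toℕ-injective z₀≡B) z₀-interior))
      where
      A-end = proj₁ (run-ends run)
      B-end = proj₂ (run-ends run)

    B<n : toℕ B < n
    B<n = ≤∧≢⇒< (toℕ≤pred[n] B) λ B≡n →
            last-out (subst InBand (toℕ-injective (trans B≡n (sym (toℕ-fromℕ n)))) B-in)

    same-value : ∀ {x y} → value x ≡ value y → x ≡ y
    same-value eq = ⟨$⟩ʳ-injective π (toℕ-injective eq)

    end-values : value A ≡ i × value B ≡ j ⊎ value A ≡ j × value B ≡ i
    end-values with boundary-value A-in (proj₁ (run-ends run)) | boundary-value B-in (proj₂ (run-ends run))
    ... | inj₁ A≡i | inj₂ B≡j = inj₁ (A≡i , B≡j)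
    ... | inj₂ A≡j | inj₁ B≡i = inj₂ (A≡j , B≡i)
    ... | inj₁ A≡i | inj₁ B≡i = ⊥-elim (<-irrefl (cong toℕ (same-value (trans A≡i (sym B≡i)))) A<B)
    ... | inj₂ A≡j | inj₂ B≡j = ⊥-elim (<-irrefl (cong toℕ (same-value (trans A≡j (sym B≡j)))) A<B)

    ψA≡B : ψ ⟨$⟩ʳ (π ⟨$⟩ʳ A) ≡ π ⟨$⟩ʳ B
    ψA≡B = toℕ-injective (+-cancelʳ-≡ (value A) _ _ (trans (ψ-inside A-in) (trans (sym (+-suc i _)) i+j)))
      where
      i+j : i + j ≡ value B + value A
      i+j with end-values
      ... | inj₁ (A≡i , B≡j) = trans (+-comm i j) (sym (cong₂ _+_ B≡j A≡i))
      ... | inj₂ (A≡j , B≡i) = sym (cong₂ _+_ B≡i A≡j)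

    boundary-position : ∀ {y} → InBand y → ¬ Interior y → y ≡ A ⊎ y ≡ B
    boundary-position y-in ¬interior with boundary-value y-in ¬interior | end-values
    ... | inj₁ y≡i | inj₁ (A≡i , _) = inj₁ (same-value (trans y≡i (sym A≡i)))
    ... | inj₁ y≡i | inj₂ (_ , B≡i) = inj₂ (same-value (trans y≡i (sym B≡i)))
    ... | inj₂ y≡j | inj₁ (_ , B≡j) = inj₂ (same-value (trans y≡j (sym B≡j)))
    ... | inj₂ y≡j | inj₂ (A≡j , _) = inj₁ (same-value (trans y≡j (sym A≡j)))

    not-A-nor-B : ∀ {y} → toℕ y < toℕ A ⊎ toℕ B < toℕ y → ¬ (y ≡ A ⊎ y ≡ B)
    not-A-nor-B (inj₁ y<A) (inj₁ refl) = <-irrefl refl y<A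
    not-A-nor-B (inj₁ y<A) (inj₂ refl) = <-asym y<A A<B
    not-A-nor-B (inj₂ B<y) (inj₁ refl) = <-asym B<y A<B
    not-A-nor-B (inj₂ B<y) (inj₂ refl) = <-irrefl refl B<y

    -- Any other position in the band would lie on a second maximal run, whose ends must again be A and B.
    block-outside : ∀ x → ¬ toℕ x ∈[ toℕ A , toℕ B ] → ¬ InBand x
    block-outside x x∉ x-in with maximal-run x-in
    ... | A′ , B′ , (A′≤x , x≤B′) , run′ with ∉[]⇒ x∉
    ...   | inj₁ x<A = not-A-nor-B (inj₁ (≤-<-trans A′≤x x<A))
                         (boundary-position (holds run′ A′ (≤-refl , ≤-trans A′≤x x≤B′)) (proj₁ (run-ends run′)))
    ...   | inj₂ B<x = not-A-nor-B (inj₂ (<-≤-trans B<x x≤B′))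
                         (boundary-position (holds run′ B′ (≤-trans A′≤x x≤B′ , ≤-refl)) (proj₂ (run-ends run′)))

    open Block A B A<B (holds run)
    open Arc B<n ψA≡B block-outside

    located-match : CyclicMatch π φ τ
    located-match = arc-match

CyclicMatch⇒Valid : ∀ {n} {π τ : Permutation′ (suc n)} {σ} → CyclicMatch π σ τ → Valid π σ
CyclicMatch⇒Valid c with CyclicMatch-fixing-last _ c refl
... | _ , c′ , fixed = fixing-last⇒Valid c′ fixed

last-or-inject₁ : ∀ {n} (x : Fin (suc n)) → x ≡ fromℕ n ⊎ ∃ λ m → x ≡ inject₁ m
last-or-inject₁ {n} x with n ℕ.≟ toℕ x
... | yes n≡x = inj₁ (toℕ-injective (trans (sym n≡x) (sym (toℕ-fromℕ n))))
... | no n≢x  = inj₂ (lower₁ x n≢x , sym (inject₁-lower₁ x n≢x))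

module _ {n} (1≤n : 1 ≤ n) (π : Permutation′ (suc n)) (I : Fin (suc n)) (K : Fin n)
         (i≤k : toℕ I ≤ toℕ K)
         (laminar : ∀ x → Laminar (Sᶜ π x) (Λ (toℕ I) (suc (toℕ K)))) where

  open FlipAction I K using (φ; image-φ-trivial)

  private
    i = toℕ I
    j = suc (toℕ K)

  trivial-match : toℕ K ≡ i → CyclicMatch π φ π
  trivial-match k≡i = record
    { reindex = idₚ ; image-step = λ _ → image-φ-trivial k≡i ; sign-step = λ _ → refl }

  whole-cycle-match : i ≡ 0 → j ≡ n → ∃ λ τ → CyclicMatch π φ τ
  whole-cycle-match i≡0 j≡n = _ , Whole.whole-match all-inside
    where
    open Reflection 1≤n π I K laminar using (InBand; value; module Whole)
    all-inside : ∀ x → InBand x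
    all-inside x = subst (_≤ value x) (sym i≡0) z≤n , subst (value x ≤_) (sym j≡n) (toℕ≤pred[n] _)

  -- Rotate π until a value w outside [i, j] comes last.
  rotated-match : (w : Fin (suc n)) → ¬ toℕ w ∈[ i , j ] → suc i < j → ∃ λ τ → CyclicMatch π φ τ
  rotated-match w w∉ i+1<j = _ , CyclicMatch-unrotate^ r located-match
    where
    r = suc (toℕ (π ⟨$⟩ˡ w))
    last↦w : rotate^ r π ⟨$⟩ʳ fromℕ n ≡ w
    last↦w = trans (rotate^-apply r π _) (trans (cong (π ⟨$⟩ʳ_) (next^-last _ _ refl)) (inverseʳ π))
    open Reflection 1≤n (rotate^ r π) I K (rotate^-steps {P = λ S → Laminar S (Λ i j)} r π laminar)
      using (module LocateArc)
    open LocateArc (subst (λ v → ¬ toℕ v ∈[ i , j ]) (sym last↦w) w∉) i+1<j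

  flip-cyclic-match : ∃ λ τ → CyclicMatch π φ τ
  flip-cyclic-match with toℕ K ℕ.≟ i
  ... | yes k≡i = π , trivial-match k≡i
  ... | no k≢i  = nontrivial (s≤s (≤∧≢⇒< i≤k (k≢i ∘ sym)))
    where
    nontrivial : suc i < j → ∃ λ τ → CyclicMatch π φ τ
    nontrivial i+1<j with i ℕ.≟ 0 | j ℕ.≟ n
    ... | yes i≡0 | yes j≡n = whole-cycle-match i≡0 j≡n
    ... | no i≢0  | _       = rotated-match Fin.zero (λ (i≤0 , _) → i≢0 (n≤0⇒n≡0 i≤0)) i+1<j
    ... | yes _   | no j≢n  = rotated-match (fromℕ n) last-out i+1<j
      where
      last-out : ¬ toℕ (fromℕ n) ∈[ i , j ]
      last-out (_ , n≤j) = j≢n (≤-antisym (toℕ<n K) (subst (_≤ j) (toℕ-fromℕ n) n≤j))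

closing-step : ∀ {n} (π : Permutation′ (suc n)) {p q} → p Fin.< q →
               (p ≡ π ⟨$⟩ʳ Fin.zero × q ≡ π ⟨$⟩ʳ fromℕ n) ⊎ (p ≡ π ⟨$⟩ʳ fromℕ n × q ≡ π ⟨$⟩ʳ Fin.zero) →
               Sᶜ π (fromℕ n) ≡ ΛI p q
closing-step π p<q (inj₁ (refl , refl)) = trans (Sᶜ-last π) (Λspan-≥ (<⇒≤ p<q))
closing-step π p<q (inj₂ (refl , refl)) = trans (Sᶜ-last π) (Λspan-≤ (<⇒≤ p<q))

lemma3p1 : (n' : ℕ) → 1 ≤ n' → (π : Permutation′ (suc n')) →
    (p q : Fin (suc n')) → p Fin.< q →
    ((p ≡ π ⟨$⟩ʳ Fin.zero × q ≡ π ⟨$⟩ʳ fromℕ n') ⊎ (p ≡ π ⟨$⟩ʳ fromℕ n' × q ≡ π ⟨$⟩ʳ Fin.zero)) →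
    (i j : Fin (suc n')) → i Fin.< j →
    (ΛI i j ⊆ ΛI p q ⊎ (ΛI p q ⊆ ΛI i j ⊎ ΛI i j ∩ ΛI p q ≡ ⊥)) →
    ((m : Fin n') → Sπ π m ⊆ ΛI i j ⊎ (ΛI i j ⊆ Sπ π m ⊎ Sπ π m ∩ ΛI i j ≡ ⊥)) →
    Valid π (flip i j)
lemma3p1 n' 1≤n π p q p<q ends I Fin.zero () ij-laminar step-laminar
lemma3p1 n' 1≤n π p q p<q ends I (Fin.suc K) i<j ij-laminar step-laminar =
  CyclicMatch⇒Valid (proj₂ (flip-cyclic-match 1≤n π I K (≤-pred i<j) laminar))
  where
  laminar : ∀ x → Laminar (Sᶜ π x) (ΛI I (Fin.suc K))
  laminar x with last-or-inject₁ x
  ... | inj₁ refl       = subst (λ S → Laminar S _) (sym (closing-step π p<q ends)) (Laminar-sym ij-laminar)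
  ... | inj₂ (m , refl) = subst (λ S → Laminar S _) (sym (Sᶜ-inject₁ π m)) (step-laminar m)
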